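{- A complete-convex \(2\)-edge-coloured graph is either a monochromatic copy of \(K_2\) or has minimum degree at least \(3\).
   Context: A \(2\)-edge-coloured graph is a pair \((G,c_G)\), \(G\) a connected graph with at least two vertices and no parallel edges, \(c_G:E_G\to\{R,B\}\). A path \(u,v,w\) with \(uv,vw\in E_G\), \(u\ne v\ne w\), is an alternating \(2\)-path with centre \(v\) if \(c_G(uv)\ne c_G(vw)\). A vertex set \(S\) is convex if no vertex outside \(S\) is the centre of an alternating \(2\)-path with both ends in \(S\); \(conv(S)\) is the smallest convex superset of \(S\). \((G,c_G)\) is complete convex if \(conv(\{u,v\})=V_G\) for every edge \(uv\). -}

module Defs where

open import Data.Nat using (ℕ; _≤_; suc; zero; _+_)
open import Data.Fin using (Fin)
open import Data.Fin.Subset using (Subset; _∈_; _∉_; _⊆_)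
open import Data.Maybe using (Maybe; just; nothing; is-just)
open import Data.Bool using (Bool; true; false; _∨_) renaming (_≟_ to _Bool≟_)
open import Data.Fin using () renaming (_≟_ to _Fin≟_)
open import Relation.Nullary.Decidable using (⌊_⌋)
open import Data.Vec using (Vec; tabulate; count)
open import Data.Product using (Σ; ∃; _×_; _,_)
open import Relation.Binary.PropositionalEquality using (_≡_; _≢_)
open import Relation.Binary.Construct.Closure.ReflexiveTransitive using (Star)
open import Relation.Nullary using (¬_)
open import Relation.Unary using (Pred)

data Colour : Set where
  R B : Colour

-- A 2-edge-coloured simple graph on vertex set Fin n, given by its
-- coloured adjacency function: col u v ≡ nothing means no edge u v,
-- col u v ≡ just c means an edge uv of colour c.  Simple: no loops,
-- undirected (symmetric); no parallel edges is automatic.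
record ColouredGraph (n : ℕ) : Set where
  field
    col       : Fin n → Fin n → Maybe Colour
    loopless  : ∀ v → col v v ≡ nothing
    symmetric : ∀ u v → col u v ≡ col v u

module _ {n : ℕ} (G : ColouredGraph n) where
  open ColouredGraph G

  Adj : Fin n → Fin n → Set
  Adj u v = ∃ λ c → col u v ≡ just c

  Connected : Set
  Connected = ∀ u v → Star Adj u v

  degree : Fin n → ℕ
  degree v = count (λ w → is-just (col v w) Bool≟ true) (tabulate (λ w → w))

  Alternating2Path : Fin n → Fin n → Fin n → Set
  Alternating2Path u v w =
    u ≢ v × v ≢ w × u ≢ w ×
    Σ Colour λ c₁ → Σ Colour λ c₂ →
      col u v ≡ just c₁ × col v w ≡ just c₂ × c₁ ≢ c₂

  Convex : Subset n → Set
  Convex S = ∀ v → v ∉ S → ¬ (∃ λ u → ∃ λ w → u ∈ S × w ∈ S × Alternating2Path u v w)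

  InConv : Subset n → Fin n → Set
  InConv S x = ∀ T → S ⊆ T → Convex T → x ∈ T

  pair : Fin n → Fin n → Subset n
  pair u v = tabulate λ x → ⌊ x Fin≟ u ⌋ ∨ ⌊ x Fin≟ v ⌋

  CompleteConvex : Set
  CompleteConvex = ∀ u v → Adj u v → ∀ x → InConv (pair u v) x

  MinDegree≥ : ℕ → Set
  MinDegree≥ k = ∀ v → k ≤ degree v

-- Let v have all its neighbours in {a, b}, with a a neighbour.  If v, b, a is not an
-- alternating 2-path, then {v, a} is convex.  Otherwise bv and ba have different colours;
-- if va has the colour of bv, no alternating 2-path is centred at v, so V ∖ {v} is convex
-- and contains the edge ab; if va has the colour of ba, then v, a, b is monochromatic and
-- {v, b} is convex.  Each is a proper convex set containing an edge, which complete
-- convexity forbids once there are three vertices.  On two vertices there is one edge.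
module Submission where

open import Defs
open import Data.Nat using (ℕ; _≤_; zero; suc; z≤n; s≤s; s≤s⁻¹)
open import Data.Nat.Properties using (_≤?_; ≰⇒>)
open import Data.Fin using (Fin; zero; suc; _≟_; punchIn; punchOut)
open import Data.Fin.Properties using (punchInᵢ≢i; punchIn-injective; punchIn-punchOut)
open import Data.Fin.Subset using (_∈_; _∉_; _⊆_; ⁅_⁆; ∁)
open import Data.Fin.Subset.Properties
  using (x∈⁅x⁆; x∈⁅y⁆⇒x≡y; x≢y⇒x∉⁅y⁆; x∈p⇒x∉∁p; x∉p⇒x∈∁p; x∉∁p⇒x∈p)
open import Data.Bool using (Bool; true; _∨_) renaming (_≟_ to _≟ᵇ_)
open import Data.Bool.Properties using (∨-zeroʳ)
open import Data.Maybe using (Maybe; just; nothing; is-just)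
open import Data.Maybe.Properties using (just-injective)
open import Data.Vec using (Vec; []; _∷_; tabulate; count)
open import Data.Vec.Properties using (lookup∘tabulate; []=⇒lookup; lookup⇒[]=)
open import Data.Vec.Membership.Propositional using () renaming (_∈_ to _∈ᵥ_)
open import Data.Vec.Membership.Propositional.Properties using (∈-tabulate⁺)
open import Data.List using (List; []; _∷_; length)
open import Data.List.Membership.Propositional using () renaming (_∈_ to _∈ₗ_)
open import Data.List.Relation.Unary.Any using (here; there)
open import Data.Vec.Relation.Unary.Any using (here; there)
open import Data.Product using (Σ; ∃; _×_; _,_)
open import Data.Sum using (_⊎_; inj₁; inj₂; swap)
open import Function using (_∘_)
open import Relation.Binary.PropositionalEquality
  using (_≡_; _≢_; refl; sym; trans; cong; subst)
open import Relation.Binary.Construct.Closure.ReflexiveTransitive using (ε; _◅_)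
open import Relation.Nullary using (¬_; Dec; yes; no; contradiction)
open import Relation.Nullary.Decidable using (⌊_⌋; ¬?; _×-dec_; dec-true; isYes≗does)
open import Relation.Unary using (Pred; Decidable)

_≟ᶜ_ : (c d : Colour) → Dec (c ≡ d)
R ≟ᶜ R = yes refl
R ≟ᶜ B = no λ ()
B ≟ᶜ R = no λ ()
B ≟ᶜ B = yes refl

≢-≢⇒≡ : {c d e : Colour} → c ≢ d → d ≢ e → c ≡ e
≢-≢⇒≡ {R} {B} {R} _ _ = refl
≢-≢⇒≡ {B} {R} {B} _ _ = refl
≢-≢⇒≡ {R} {R} c≢d _ = contradiction refl c≢d
≢-≢⇒≡ {B} {B} c≢d _ = contradiction refl c≢d
≢-≢⇒≡ {_} {R} {R} _ d≢e = contradiction refl d≢e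
≢-≢⇒≡ {_} {B} {B} _ d≢e = contradiction refl d≢e

distinct-colours? : (m₁ m₂ : Maybe Colour) →
  Dec (Σ Colour λ c₁ → Σ Colour λ c₂ → m₁ ≡ just c₁ × m₂ ≡ just c₂ × c₁ ≢ c₂)
distinct-colours? nothing _ = no λ { (_ , _ , () , _) }
distinct-colours? (just _) nothing = no λ { (_ , _ , _ , () , _) }
distinct-colours? (just c₁) (just c₂) with c₁ ≟ᶜ c₂
... | yes refl = no λ { (_ , _ , refl , refl , c≢c) → c≢c refl }
... | no c₁≢c₂ = yes (c₁ , c₂ , refl , refl , c₁≢c₂)

x∈tabulate⇒fx≡true : ∀ {n} {f : Fin n → Bool} {x} → x ∈ tabulate f → f x ≡ true
x∈tabulate⇒fx≡true {f = f} {x} x∈ = trans (sym (lookup∘tabulate f x)) ([]=⇒lookup x∈)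

fx≡true⇒x∈tabulate : ∀ {n} {f : Fin n → Bool} {x} → f x ≡ true → x ∈ tabulate f
fx≡true⇒x∈tabulate {f = f} {x} fx = lookup⇒[]= x (tabulate f) (trans (lookup∘tabulate f x) fx)

⌊x≟x⌋≡true : ∀ {n} (x : Fin n) → ⌊ x ≟ x ⌋ ≡ true
⌊x≟x⌋≡true x = trans (isYes≗does (x ≟ x)) (dec-true (x ≟ x) refl)

module _ {a p} {A : Set a} {P : Pred A p} (P? : Decidable P) where

  count≤⇒covering-list : ∀ {m k} (xs : Vec A m) → count P? xs ≤ k →
    ∃ λ (ys : List A) → length ys ≤ k × (∀ {x} → x ∈ᵥ xs → P x → x ∈ₗ ys)
  count≤⇒covering-list [] _ = [] , z≤n , λ ()
  count≤⇒covering-list (x ∷ xs) c with P? x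
  count≤⇒covering-list (x ∷ xs) (s≤s c) | yes _ with count≤⇒covering-list xs c
  ... | ys , ∣ys∣≤k , covers = x ∷ ys , s≤s ∣ys∣≤k , λ
    { (here refl) _ → here refl
    ; (there y∈xs) Py → there (covers y∈xs Py) }
  count≤⇒covering-list (x ∷ xs) c | no ¬Px with count≤⇒covering-list xs c
  ... | ys , ∣ys∣≤k , covers = ys , ∣ys∣≤k , λ
    { (here refl) Px → contradiction Px ¬Px
    ; (there y∈xs) Py → covers y∈xs Py }

length≤2⇒⊆pair : ∀ {A : Set} {a : A} {ys : List A} → a ∈ₗ ys → length ys ≤ 2 →
  ∃ λ b → ∀ {w} → w ∈ₗ ys → w ≡ a ⊎ w ≡ b
length≤2⇒⊆pair {ys = y ∷ []} (here refl) _ = y , λ { (here w≡y) → inj₁ w≡y }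
length≤2⇒⊆pair {ys = y ∷ z ∷ []} (here refl) _ = z , λ
  { (here w≡y) → inj₁ w≡y ; (there (here w≡z)) → inj₂ w≡z }
length≤2⇒⊆pair {ys = y ∷ z ∷ []} (there (here refl)) _ = y , λ
  { (here w≡y) → inj₂ w≡y ; (there (here w≡z)) → inj₁ w≡z }
length≤2⇒⊆pair {ys = _ ∷ _ ∷ _ ∷ _} _ (s≤s (s≤s ()))

avoid-two : ∀ {k} (p q : Fin (suc (suc (suc k)))) → ∃ λ x → x ≢ p × x ≢ q
avoid-two {k} p q with p ≟ q
... | yes refl = punchIn p zero , punchInᵢ≢i p zero , punchInᵢ≢i p zero
... | no p≢q = punchIn p y , punchInᵢ≢i p y , punchIn-y≢q
  where
  -- q = punchIn p q₀, so punching in at p any y ≢ q₀ avoids both p and q.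
  q₀ : Fin (suc (suc k))
  q₀ = punchOut p≢q
  y : Fin (suc (suc k))
  y = punchIn q₀ zero
  punchIn-y≢q : punchIn p y ≢ q
  punchIn-y≢q e =
    punchInᵢ≢i q₀ zero (punchIn-injective p y q₀ (trans e (sym (punchIn-punchOut p≢q))))

module _ {n : ℕ} (G : ColouredGraph n) where
  open ColouredGraph G

  Adj⇒≢ : ∀ {u v} → Adj G u v → u ≢ v
  Adj⇒≢ {u} (_ , e) refl = contradiction (trans (sym (loopless u)) e) λ ()

  Adj⇒is-just : ∀ {u v} → Adj G u v → is-just (col u v) ≡ true
  Adj⇒is-just (_ , e) = cong is-just e

  connected⇒neighbour : Connected G → ∀ {u v} → u ≢ v → ∃ (Adj G u)
  connected⇒neighbour conn {u} {v} u≢v with conn u v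
  ... | ε = contradiction refl u≢v
  ... | u∼w ◅ _ = _ , u∼w

  ∈-pair⁻ : ∀ {u w x} → x ∈ pair G u w → x ≡ u ⊎ x ≡ w
  ∈-pair⁻ {u} {w} {x} x∈ with x ≟ u | x ≟ w | x∈tabulate⇒fx≡true x∈
  ... | yes x≡u | _ | _ = inj₁ x≡u
  ... | no _ | yes x≡w | _ = inj₂ x≡w
  ... | no _ | no _ | ()

  ∈-pair⁺ˡ : ∀ {u w} → u ∈ pair G u w
  ∈-pair⁺ˡ {u} {w} = fx≡true⇒x∈tabulate (cong (_∨ ⌊ u ≟ w ⌋) (⌊x≟x⌋≡true u))

  ∈-pair⁺ʳ : ∀ {u w} → w ∈ pair G u w
  ∈-pair⁺ʳ {u} {w} =
    fx≡true⇒x∈tabulate (trans (cong (⌊ w ≟ u ⌋ ∨_) (⌊x≟x⌋≡true w)) (∨-zeroʳ ⌊ w ≟ u ⌋))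

  ∉-pair⁻ : ∀ {u w x} → x ∉ pair G u w → x ≢ u × x ≢ w
  ∉-pair⁻ x∉ = (λ { refl → x∉ ∈-pair⁺ˡ }) , (λ { refl → x∉ ∈-pair⁺ʳ })

  alternating? : ∀ u x w → Dec (Alternating2Path G u x w)
  alternating? u x w =
    ¬? (u ≟ x) ×-dec ¬? (x ≟ w) ×-dec ¬? (u ≟ w) ×-dec distinct-colours? (col u x) (col x w)

  alternating-reverse : ∀ {u x w} → Alternating2Path G u x w → Alternating2Path G w x u
  alternating-reverse {u} {x} {w} (u≢x , x≢w , u≢w , c₁ , c₂ , e₁ , e₂ , c₁≢c₂) =
    x≢w ∘ sym , u≢x ∘ sym , u≢w ∘ sym , c₂ , c₁ ,
    trans (symmetric w x) e₂ , trans (symmetric x u) e₁ , c₁≢c₂ ∘ sym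

  alternating⇒Adj : ∀ {u x w} → Alternating2Path G u x w → Adj G u x
  alternating⇒Adj (_ , _ , _ , c₁ , _ , e₁ , _) = c₁ , e₁

  monochromatic⇒¬alternating : ∀ {u x w c} → col u x ≡ just c → col x w ≡ just c →
    ¬ Alternating2Path G u x w
  monochromatic⇒¬alternating e₁ e₂ (_ , _ , _ , _ , _ , f₁ , f₂ , c₁≢c₂) =
    c₁≢c₂ (just-injective (trans (sym f₁) (trans e₁ (trans (sym e₂) f₂))))

  pair-convex : ∀ {u w} → (∀ x → x ≢ u → x ≢ w → ¬ Alternating2Path G u x w) →
    Convex G (pair G u w)
  pair-convex no-path x x∉ (y , z , y∈ , z∈ , path@(_ , _ , y≢z , _))
    with ∉-pair⁻ x∉ | ∈-pair⁻ y∈ | ∈-pair⁻ z∈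
  ... | _ | inj₁ refl | inj₁ refl = y≢z refl
  ... | _ | inj₂ refl | inj₂ refl = y≢z refl
  ... | x≢u , x≢w | inj₁ refl | inj₂ refl = no-path x x≢u x≢w path
  ... | x≢u , x≢w | inj₂ refl | inj₁ refl = no-path x x≢u x≢w (alternating-reverse path)

  monochromatic-star⇒∁-convex : ∀ {v c} → (∀ w → Adj G v w → col v w ≡ just c) →
    Convex G (∁ ⁅ v ⁆)
  monochromatic-star⇒∁-convex {v} star x x∉ (u , w , _ , _ , path@(_ , _ , _ , _ , _ , e₁ , e₂ , _))
    with x∈⁅y⁆⇒x≡y v (x∉∁p⇒x∈p x∉)
  ... | refl = monochromatic⇒¬alternating
    (trans (symmetric u v) (star u (_ , trans (symmetric v u) e₁))) (star w (_ , e₂)) path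

  neighbours⊆pair∧¬alternating⇒pair-convex : ∀ {v a b} →
    (∀ w → Adj G v w → w ≡ a ⊎ w ≡ b) → ¬ Alternating2Path G v b a → Convex G (pair G v a)
  neighbours⊆pair∧¬alternating⇒pair-convex {v} {a} {b} N⊆ ¬vba = pair-convex centre-is-b
    where
    centre-is-b : ∀ x → x ≢ v → x ≢ a → ¬ Alternating2Path G v x a
    centre-is-b x _ x≢a vxa with N⊆ x (alternating⇒Adj vxa)
    ... | inj₁ x≡a = x≢a x≡a
    ... | inj₂ refl = ¬vba vxa

  degree≤2⇒neighbours⊆pair : ∀ {v a} → degree G v ≤ 2 → Adj G v a →
    ∃ λ b → ∀ w → Adj G v w → w ≡ a ⊎ w ≡ b
  degree≤2⇒neighbours⊆pair {v} deg≤2 va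
    with count≤⇒covering-list (λ w → is-just (col v w) ≟ᵇ true) (tabulate λ w → w) deg≤2
  ... | ys , ∣ys∣≤2 , covers =
    let b , ys⊆ab = length≤2⇒⊆pair (neighbour∈ys va) ∣ys∣≤2 in b , λ _ vw → ys⊆ab (neighbour∈ys vw)
    where
    neighbour∈ys : ∀ {w} → Adj G v w → w ∈ₗ ys
    neighbour∈ys {w} vw = covers (∈-tabulate⁺ (λ w → w) w) (Adj⇒is-just vw)

  module _ (cc : CompleteConvex G) where

    convex⊇edge⇒full : ∀ {u w S} → Adj G u w → Convex G S → u ∈ S → w ∈ S → ∀ x → x ∈ S
    convex⊇edge⇒full {u} {w} {S} uw convex u∈ w∈ x = cc u w uw x S pair⊆S convex
      where
      pair⊆S : pair G u w ⊆ S
      pair⊆S y∈ with ∈-pair⁻ y∈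
      ... | inj₁ refl = u∈
      ... | inj₂ refl = w∈

    module _ (avoid : ∀ (p q : Fin n) → ∃ λ x → x ≢ p × x ≢ q) where

      pair-not-convex : ∀ {u w} → Adj G u w → ¬ Convex G (pair G u w)
      pair-not-convex {u} {w} uw convex with avoid u w
      ... | x , x≢u , x≢w with ∈-pair⁻ (convex⊇edge⇒full uw convex ∈-pair⁺ˡ ∈-pair⁺ʳ x)
      ... | inj₁ x≡u = x≢u x≡u
      ... | inj₂ x≡w = x≢w x≡w

      neighbours⊈pair : ∀ {v a b} → Adj G v a → ¬ (∀ w → Adj G v w → w ≡ a ⊎ w ≡ b)
      neighbours⊈pair {v} {a} {b} va@(c₀ , e₀) N⊆ with alternating? v b a
      ... | no ¬vba = pair-not-convex va (neighbours⊆pair∧¬alternating⇒pair-convex N⊆ ¬vba)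
      ... | yes (v≢b , _ , _ , c₁ , c₂ , e₁ , e₂ , c₁≢c₂) with c₀ ≟ᶜ c₁
      ...   | yes refl = x∈p⇒x∉∁p (x∈⁅x⁆ v)
              (convex⊇edge⇒full (c₂ , e₂) (monochromatic-star⇒∁-convex star) b∈ a∈ v)
        where
        star : ∀ w → Adj G v w → col v w ≡ just c₀
        star w vw with N⊆ w vw
        ... | inj₁ refl = e₀
        ... | inj₂ refl = e₁
        b∈ : b ∈ ∁ ⁅ v ⁆
        b∈ = x∉p⇒x∈∁p (x≢y⇒x∉⁅y⁆ (v≢b ∘ sym))
        a∈ : a ∈ ∁ ⁅ v ⁆
        a∈ = x∉p⇒x∈∁p (x≢y⇒x∉⁅y⁆ (Adj⇒≢ va ∘ sym))
      ...   | no c₀≢c₁ = pair-not-convex (c₁ , e₁)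
              (neighbours⊆pair∧¬alternating⇒pair-convex (λ w → swap ∘ N⊆ w) ¬vab)
        where
        ¬vab : ¬ Alternating2Path G v a b
        ¬vab = monochromatic⇒¬alternating e₀
          (trans (symmetric a b) (subst (λ c → col b a ≡ just c) (sym (≢-≢⇒≡ c₀≢c₁ c₁≢c₂)) e₂))

      completeConvex⇒minDegree≥3 : Connected G → MinDegree≥ G 3
      completeConvex⇒minDegree≥3 conn v with 3 ≤? degree G v
      ... | yes 3≤deg = 3≤deg
      ... | no 3≰deg with avoid v v
      ... | u , u≢v , _ with connected⇒neighbour conn (u≢v ∘ sym)
      ... | a , va with degree≤2⇒neighbours⊆pair (s≤s⁻¹ (≰⇒> 3≰deg)) va
      ... | b , N⊆ = contradiction N⊆ (neighbours⊈pair va)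

K₂-monochromatic : (G : ColouredGraph 2) → Connected G →
  ∃ λ c → ∀ u v → Adj G u v → ColouredGraph.col G u v ≡ just c
K₂-monochromatic G conn with connected⇒neighbour G conn {zero} {suc zero} (λ ())
... | w , c , e = c , λ u v uv → trans (col≡col₀₁ u v uv) (trans (sym (col≡col₀₁ zero w (c , e))) e)
  where
  open ColouredGraph G
  col≡col₀₁ : ∀ u v → Adj G u v → col u v ≡ col zero (suc zero)
  col≡col₀₁ zero zero uv = contradiction refl (Adj⇒≢ G uv)
  col≡col₀₁ zero (suc zero) _ = refl
  col≡col₀₁ (suc zero) zero _ = symmetric (suc zero) zero
  col≡col₀₁ (suc zero) (suc zero) uv = contradiction refl (Adj⇒≢ G uv)

theorem14 : (n : ℕ) → (G : ColouredGraph n) → 2 ≤ n → Connected G →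
    CompleteConvex G →
    (n ≡ 2 × ∃ λ c → ∀ u v → Adj G u v → ColouredGraph.col G u v ≡ just c)
    ⊎ MinDegree≥ G 3
theorem14 zero G () _ _
theorem14 (suc zero) G (s≤s ()) _ _
theorem14 (suc (suc zero)) G _ conn _ = inj₁ (refl , K₂-monochromatic G conn)
theorem14 (suc (suc (suc k))) G _ conn cc = inj₂ (completeConvex⇒minDegree≥3 G cc avoid-two conn)
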